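{- Let $m,k$ be positive integers and $t$ a positive integer with $t<(m-1)/4$. Let $\mathcal{C}=\{2i : 2\leq i\leq t\}\cup\{1,2t+1\}$ and $c(x)=1+\sum_{j\in\mathcal{C}}(x^j+x^{m-j})\in\mathbb{F}_2[x]$. Then $\gcd(c(x^k),x^m-1)=1$ in $\mathbb{F}_2[x]$ if and only if $\gcd(m,(2t+3)k)=\gcd(m,(2t-1)k)=\gcd(m,3k)=\gcd(m,k)$.
   Context: In the paper's terminology this says $\mathcal{C}$ is a QBF-set with respect to $(n,k)$, $n=em$: a set $\mathcal{C}$ of indices is a QBF-set if $c(x)=1+\sum_{j\in\mathcal{C}}(x^j+x^{m-j})$ satisfies $\gcd(c(x^k),x^m-1)=1$ over $\mathbb{F}_2$. -}

module Defs where

open import Data.Bool using (Bool; true; false; if_then_else_; _xor_)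
open import Data.Nat using (ℕ; zero; suc; _+_; _*_; _∸_)
open import Data.List using (List; []; _∷_; map; foldr; replicate; _++_; upTo)
open import Data.Product using (∃)
open import Relation.Binary.PropositionalEquality using (_≡_)

-- Polynomials over F₂ = Bool (xor is addition, ∧ multiplication),
-- as coefficient lists, lowest degree first; trailing zeros are allowed
-- and ignored by the equality _≈P_.
Poly : Set
Poly = List Bool

coeff : Poly → ℕ → Bool
coeff []      _       = false
coeff (a ∷ p) zero    = a
coeff (a ∷ p) (suc n) = coeff p n

_≈P_ : Poly → Poly → Set
p ≈P q = ∀ n → coeff p n ≡ coeff q n

infixl 6 _+P_
infixl 7 _*P_

_+P_ : Poly → Poly → Poly
[]      +P q       = q
(a ∷ p) +P []      = a ∷ p
(a ∷ p) +P (b ∷ q) = (a xor b) ∷ (p +P q)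

_*P_ : Poly → Poly → Poly
[]      *P q = []
(a ∷ p) *P q = (if a then q else []) +P (false ∷ (p *P q))

oneP : Poly
oneP = true ∷ []

X^ : ℕ → Poly
X^ j = replicate j false ++ (true ∷ [])

sumP : List Poly → Poly
sumP = foldr _+P_ []

_∣P_ : Poly → Poly → Set
d ∣P p = ∃ λ q → (d *P q) ≈P p

-- gcd(a,b) = 1 in F₂[x]: every common divisor divides 1 (is a unit)
CoprimeP : Poly → Poly → Set
CoprimeP a b = ∀ d → d ∣P a → d ∣P b → d ∣P oneP

-- the index set 𝒞 = {2i : 2 ≤ i ≤ t} ∪ {1, 2t+1}, as a list
-- (its elements are pairwise distinct)
indexSet : ℕ → List ℕ
indexSet t = 1 ∷ (2 * t + 1) ∷ map (λ i → 2 * (i + 2)) (upTo (t ∸ 1))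

cOfXk : ℕ → ℕ → ℕ → Poly
cOfXk m k t = oneP +P sumP (map (λ j → X^ (j * k) +P X^ ((m ∸ j) * k)) (indexSet t))

-- x^m - 1 = x^m + 1 over F₂
xm-1 : ℕ → Poly
xm-1 m = X^ m +P oneP

-- Write y = x^k and s = 2t + 1. Modulo x^m − 1 the monomial x^{(m−j)k} is the inverse of y^j, so
-- y^s · c(x^k) is congruent to a polynomial in y; multiplying by (y + 1)³ = (y + 1)(y² + 1) makes the
-- sum over the even indices telescope, and one finds
--   y^s · c(x^k) · (y + 1)³ ≡ (y^{s+2} + 1)(y^{s−2} + 1)(y³ + 1)   (mod x^m − 1).
-- Together with gcd(x^a − 1, x^b − 1) = x^{gcd(a,b)} − 1 and c(x^k) ≡ 1 (mod x^k − 1) this gives both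
-- directions. If the three gcds equal g = gcd(m,k), a common divisor of c(x^k) and x^m − 1 divides the
-- right-hand side, hence (x^g − 1)³ and (x^k − 1)³, so it is a unit because c(x^k) ≡ 1 (mod x^k − 1).
-- Conversely, for e ∈ {2t+3, 2t−1, 3} the polynomial H = x^{gcd(m,ek)} − 1 divides x^m − 1 and the
-- right-hand side; being coprime to c(x^k) and to y, it divides (x^k − 1)³ and hence x^{4k} − 1.
-- So gcd(m,ek) divides 4k, and as e is odd it divides k.

module Submission where

open import Defs
open import Algebra.Bundles using (CommutativeSemiring; CommutativeRing)
open import Algebra.Structures.Biased using (IsCommutativeSemiringˡ)
import Algebra.Properties.CommutativeSemigroup as CommSemigroupProperties
open import Data.Bool using (Bool; true; false; if_then_else_; _xor_; _∧_)
open import Data.Bool.Properties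
  using (xor-comm; xor-assoc; xor-identityʳ; xor-same; ∧-comm; xor-∧-commutativeRing)
open import Data.Empty using (⊥-elim)
open import Data.List using (List; []; _∷_; _∷ʳ_; length; replicate; map; upTo)
open import Data.List.Properties using (length-++; length-replicate; upTo-∷ʳ)
open import Data.Maybe using (Maybe; just; nothing)
import Data.Maybe as Maybe
open import Data.Nat using (ℕ; zero; suc; _+_; _*_; _∸_; _≤_; _<_; s≤s; z≤n; _/_; _%_)
import Data.Nat.Properties as ℕ
import Data.Nat.Divisibility as ℕᵈ
open import Data.Nat.DivMod using (m≡m%n+[m/n]*n; m%n<n)
open import Data.Nat.GCD using (gcd; gcd-GCD; gcd[m,n]∣m; gcd[m,n]∣n; gcd-greatest; gcd[m,n]≢0)
  renaming (module Bézout to ℕ-Bézout)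
import Data.Nat.Tactic.RingSolver as ℕ-Solver
open import Data.Product using (_,_; _×_; ∃; ∃₂)
open import Data.Sum using (_⊎_; inj₁; inj₂)
open import Function using (id; _∘_)
open import Function.Bundles using (_⇔_; mk⇔)
open import Relation.Nullary using (¬_)
open import Relation.Binary.Bundles using (Setoid)
open import Relation.Binary.Structures using (IsEquivalence)
open import Relation.Binary.PropositionalEquality as ≡ using (_≡_; _≢_; refl; cong; cong₂)
import Relation.Binary.Reasoning.Setoid as ≈-Reasoning
open import Tactic.RingSolver using (solve-∀)
open import Tactic.RingSolver.Core.AlmostCommutativeRing using (AlmostCommutativeRing)

-- 𝔽₂[x] as a commutative semiring

-- Wrapping _≈P_ in a record lets Agda infer p and q from a proof of p ≋ q.
infix 4 _≋_
record _≋_ (p q : Poly) : Set where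
  constructor mk≋
  field coeff-≡ : p ≈P q
open _≋_ public

≋-refl : ∀ {p} → p ≋ p
≋-refl = mk≋ λ _ → refl

≋-sym : ∀ {p q} → p ≋ q → q ≋ p
≋-sym (mk≋ e) = mk≋ λ n → ≡.sym (e n)

≋-trans : ∀ {p q r} → p ≋ q → q ≋ r → p ≋ r
≋-trans (mk≋ e) (mk≋ f) = mk≋ λ n → ≡.trans (e n) (f n)

≋-reflexive : ∀ {p q} → p ≡ q → p ≋ q
≋-reflexive refl = ≋-refl

≋-isEquivalence : IsEquivalence _≋_
≋-isEquivalence = record { refl = ≋-refl ; sym = ≋-sym ; trans = ≋-trans }

≋-setoid : Setoid _ _
≋-setoid = record { isEquivalence = ≋-isEquivalence }

≋-cons : ∀ {a p q} → p ≋ q → a ∷ p ≋ a ∷ q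
≋-cons (mk≋ e) = mk≋ λ { zero → refl ; (suc n) → e n }

false∷[]≋[] : false ∷ [] ≋ []
false∷[]≋[] = mk≋ λ { zero → refl ; (suc n) → refl }

coeff-+ : ∀ p q n → coeff (p +P q) n ≡ coeff p n xor coeff q n
coeff-+ []      q       n       = refl
coeff-+ (a ∷ p) []      n       = ≡.sym (xor-identityʳ _)
coeff-+ (a ∷ p) (b ∷ q) zero    = refl
coeff-+ (a ∷ p) (b ∷ q) (suc n) = coeff-+ p q n

module XorProperties = CommSemigroupProperties
  (CommutativeRing.+-commutativeSemigroup xor-∧-commutativeRing)

+P-cong : ∀ {p p′ q q′} → p ≋ p′ → q ≋ q′ → p +P q ≋ p′ +P q′
+P-cong {p} {p′} {q} {q′} (mk≋ e) (mk≋ f) = mk≋ λ n →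
  ≡.trans (coeff-+ p q n) (≡.trans (cong₂ _xor_ (e n) (f n)) (≡.sym (coeff-+ p′ q′ n)))

+P-comm : ∀ p q → p +P q ≋ q +P p
+P-comm p q = mk≋ λ n →
  ≡.trans (coeff-+ p q n) (≡.trans (xor-comm (coeff p n) _) (≡.sym (coeff-+ q p n)))

+P-assoc : ∀ p q r → (p +P q) +P r ≋ p +P (q +P r)
+P-assoc p q r = mk≋ λ n → begin
  coeff ((p +P q) +P r) n                  ≡⟨ coeff-+ (p +P q) r n ⟩
  coeff (p +P q) n xor coeff r n           ≡⟨ cong (_xor coeff r n) (coeff-+ p q n) ⟩
  (coeff p n xor coeff q n) xor coeff r n  ≡⟨ xor-assoc (coeff p n) _ _ ⟩
  coeff p n xor (coeff q n xor coeff r n)  ≡⟨ cong (coeff p n xor_) (coeff-+ q r n) ⟨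
  coeff p n xor coeff (q +P r) n           ≡⟨ coeff-+ p (q +P r) n ⟨
  coeff (p +P (q +P r)) n                  ∎
  where open ≡.≡-Reasoning

+P-identityʳ : ∀ p → p +P [] ≋ p
+P-identityʳ p = mk≋ λ n → ≡.trans (coeff-+ p [] n) (xor-identityʳ (coeff p n))

+P-self : ∀ p → p +P p ≋ []
+P-self p = mk≋ λ n → ≡.trans (coeff-+ p p n) (xor-same (coeff p n))

+P-interchange : ∀ p q r s → (p +P q) +P (r +P s) ≋ (p +P r) +P (q +P s)
+P-interchange p q r s = mk≋ λ n → begin
  coeff ((p +P q) +P (r +P s)) n
    ≡⟨ coeff-+ (p +P q) (r +P s) n ⟩
  coeff (p +P q) n xor coeff (r +P s) n
    ≡⟨ cong₂ _xor_ (coeff-+ p q n) (coeff-+ r s n) ⟩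
  (coeff p n xor coeff q n) xor (coeff r n xor coeff s n)
    ≡⟨ XorProperties.interchange (coeff p n) _ _ _ ⟩
  (coeff p n xor coeff r n) xor (coeff q n xor coeff s n)
    ≡⟨ cong₂ _xor_ (coeff-+ p r n) (coeff-+ q s n) ⟨
  coeff (p +P r) n xor coeff (q +P s) n
    ≡⟨ coeff-+ (p +P r) (q +P s) n ⟨
  coeff ((p +P r) +P (q +P s)) n
    ∎
  where open ≡.≡-Reasoning

scale : Bool → Poly → Poly
scale a p = if a then p else []

scale-+P : ∀ a p q → scale a (p +P q) ≋ scale a p +P scale a q
scale-+P true  p q = ≋-refl
scale-+P false p q = ≋-refl

scale-xor : ∀ a b p → scale (a xor b) p ≋ scale a p +P scale b p
scale-xor true  true  p = ≋-sym (+P-self p)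
scale-xor true  false p = ≋-sym (+P-identityʳ p)
scale-xor false b     p = ≋-refl

*P-annihilatedˡ : ∀ p q → p ≋ [] → p *P q ≋ []
*P-annihilatedˡ []          q e        = ≋-refl
*P-annihilatedˡ (true ∷ p)  q (mk≋ e) with () ← e zero
*P-annihilatedˡ (false ∷ p) q (mk≋ e) =
  ≋-trans (≋-cons (*P-annihilatedˡ p q (mk≋ λ n → e (suc n)))) false∷[]≋[]

*P-congˡ : ∀ {p p′} q → p ≋ p′ → p *P q ≋ p′ *P q
*P-congˡ {[]}    {p′}     q e = ≋-sym (*P-annihilatedˡ p′ q (≋-sym e))
*P-congˡ {a ∷ p} {[]}     q e = *P-annihilatedˡ (a ∷ p) q e
*P-congˡ {a ∷ p} {_ ∷ p′} q (mk≋ e) with refl ← e zero =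
  +P-cong {scale a q} ≋-refl (≋-cons (*P-congˡ {p} {p′} q (mk≋ λ n → e (suc n))))

*P-congʳ : ∀ p {q q′} → q ≋ q′ → p *P q ≋ p *P q′
*P-congʳ []          e = ≋-refl
*P-congʳ (true ∷ p)  e = +P-cong e (≋-cons (*P-congʳ p e))
*P-congʳ (false ∷ p) e = ≋-cons (*P-congʳ p e)

*P-cong : ∀ {p p′ q q′} → p ≋ p′ → q ≋ q′ → p *P q ≋ p′ *P q′
*P-cong {p′ = p′} {q} e f = ≋-trans (*P-congˡ q e) (*P-congʳ p′ f)

*P-zeroʳ : ∀ p → p *P [] ≋ []
*P-zeroʳ []      = ≋-refl
*P-zeroʳ (a ∷ p) = ≋-trans (+P-cong (lemma a) (≋-cons (*P-zeroʳ p))) false∷[]≋[]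
  where
  lemma : ∀ a → scale a [] ≋ []
  lemma true  = ≋-refl
  lemma false = ≋-refl

*P-distribˡ : ∀ p q r → p *P (q +P r) ≋ p *P q +P p *P r
*P-distribˡ []      q r = ≋-refl
*P-distribˡ (a ∷ p) q r =
  ≋-trans (+P-cong (scale-+P a q r) (≋-cons (*P-distribˡ p q r)))
          (+P-interchange (scale a q) (scale a r) (false ∷ p *P q) (false ∷ p *P r))

*P-distribʳ : ∀ p q r → (p +P q) *P r ≋ p *P r +P q *P r
*P-distribʳ []      q       r = ≋-refl
*P-distribʳ (a ∷ p) []      r = ≋-sym (+P-identityʳ _)
*P-distribʳ (a ∷ p) (b ∷ q) r =
  ≋-trans (+P-cong (scale-xor a b r) (≋-cons (*P-distribʳ p q r)))
          (+P-interchange (scale a r) (scale b r) (false ∷ p *P r) (false ∷ q *P r))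

coeff-scale : ∀ a p n → coeff (scale a p) n ≡ a ∧ coeff p n
coeff-scale true  p n       = refl
coeff-scale false p zero    = refl
coeff-scale false p (suc n) = refl

*P-∷ : ∀ p b q → p *P (b ∷ q) ≋ scale b p +P (false ∷ p *P q)
*P-∷ []      true  q = ≋-sym false∷[]≋[]
*P-∷ []      false q = ≋-sym false∷[]≋[]
*P-∷ (a ∷ p) b     q = mk≋ coeffs
  where
  open ≡.≡-Reasoning
  coeffs : ((a ∷ p) *P (b ∷ q)) ≈P (scale b (a ∷ p) +P (false ∷ (a ∷ p) *P q))
  coeffs zero = begin
    coeff (scale a (b ∷ q) +P (false ∷ p *P (b ∷ q))) 0  ≡⟨ coeff-+ (scale a (b ∷ q)) _ 0 ⟩
    coeff (scale a (b ∷ q)) 0 xor false                  ≡⟨ cong (_xor false) (coeff-scale a (b ∷ q) 0) ⟩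
    (a ∧ b) xor false                                    ≡⟨ cong (_xor false) (∧-comm a b) ⟩
    (b ∧ a) xor false                                    ≡⟨ cong (_xor false) (coeff-scale b (a ∷ p) 0) ⟨
    coeff (scale b (a ∷ p)) 0 xor false                  ≡⟨ coeff-+ (scale b (a ∷ p)) _ 0 ⟨
    coeff (scale b (a ∷ p) +P (false ∷ (a ∷ p) *P q)) 0  ∎
  coeffs (suc n) = begin
    coeff (scale a (b ∷ q) +P (false ∷ p *P (b ∷ q))) (suc n)
      ≡⟨ coeff-+ (scale a (b ∷ q)) _ (suc n) ⟩
    coeff (scale a (b ∷ q)) (suc n) xor coeff (p *P (b ∷ q)) n
      ≡⟨ cong₂ _xor_ (coeff-scale a (b ∷ q) (suc n))
                     (≡.trans (coeff-≡ (*P-∷ p b q) n) (coeff-+ (scale b p) _ n)) ⟩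
    (a ∧ coeff q n) xor (coeff (scale b p) n xor r)
      ≡⟨ cong (λ x → (a ∧ coeff q n) xor (x xor r)) (coeff-scale b p n) ⟩
    (a ∧ coeff q n) xor ((b ∧ coeff p n) xor r)
      ≡⟨ XorProperties.x∙yz≈y∙xz (a ∧ coeff q n) (b ∧ coeff p n) r ⟩
    (b ∧ coeff p n) xor ((a ∧ coeff q n) xor r)
      ≡⟨ cong (λ x → (b ∧ coeff p n) xor (x xor r)) (coeff-scale a q n) ⟨
    (b ∧ coeff p n) xor (coeff (scale a q) n xor r)
      ≡⟨ cong ((b ∧ coeff p n) xor_) (coeff-+ (scale a q) _ n) ⟨
    (b ∧ coeff p n) xor coeff ((a ∷ p) *P q) n
      ≡⟨ cong (_xor coeff ((a ∷ p) *P q) n) (coeff-scale b (a ∷ p) (suc n)) ⟨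
    coeff (scale b (a ∷ p)) (suc n) xor coeff ((a ∷ p) *P q) n
      ≡⟨ coeff-+ (scale b (a ∷ p)) _ (suc n) ⟨
    coeff (scale b (a ∷ p) +P (false ∷ (a ∷ p) *P q)) (suc n)
      ∎
    where r = coeff (false ∷ p *P q) n

*P-comm : ∀ p q → p *P q ≋ q *P p
*P-comm []      q = ≋-sym (*P-zeroʳ q)
*P-comm (a ∷ p) q =
  ≋-trans (+P-cong {scale a q} ≋-refl (≋-cons (*P-comm p q))) (≋-sym (*P-∷ q a p))

*P-assoc : ∀ p q r → (p *P q) *P r ≋ p *P (q *P r)
*P-assoc []      q r = ≋-refl
*P-assoc (a ∷ p) q r =
  ≋-trans (*P-distribʳ (scale a q) (false ∷ p *P q) r)
          (+P-cong (scale-*P a) (≋-cons (*P-assoc p q r)))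
  where
  scale-*P : ∀ a → scale a q *P r ≋ scale a (q *P r)
  scale-*P true  = ≋-refl
  scale-*P false = ≋-refl

*P-identityˡ : ∀ p → oneP *P p ≋ p
*P-identityˡ p = ≋-trans (+P-cong {p} ≋-refl false∷[]≋[]) (+P-identityʳ p)

*P-identityʳ : ∀ p → p *P oneP ≋ p
*P-identityʳ p = ≋-trans (*P-comm p oneP) (*P-identityˡ p)

𝔽₂[x] : CommutativeSemiring _ _
𝔽₂[x] = record
  { isCommutativeSemiring = IsCommutativeSemiringˡ.isCommutativeSemiring record
    { +-isCommutativeMonoid = record
      { isMonoid = record
        { isSemigroup = record
          { isMagma = record { isEquivalence = ≋-isEquivalence ; ∙-cong = +P-cong }
          ; assoc = +P-assoc }
        ; identity = (λ _ → ≋-refl) , +P-identityʳ }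
      ; comm = +P-comm }
    ; *-isCommutativeMonoid = record
      { isMonoid = record
        { isSemigroup = record
          { isMagma = record { isEquivalence = ≋-isEquivalence ; ∙-cong = *P-cong }
          ; assoc = *P-assoc }
        ; identity = *P-identityˡ , *P-identityʳ }
      ; comm = *P-comm }
    ; distribʳ = λ r p q → *P-distribʳ p q r
    ; zeroˡ = λ _ → ≋-refl }
  }

-- The solver drops every coefficient that ≟[] recognises as zero; this is how it knows that 1 + 1 = 0.
≟[] : ∀ p → Maybe ([] ≋ p)
≟[] []          = just ≋-refl
≟[] (true ∷ p)  = nothing
≟[] (false ∷ p) = Maybe.map (λ e → ≋-trans (≋-sym false∷[]≋[]) (≋-cons e)) (≟[] p)

𝔽₂[x]-ring : AlmostCommutativeRing _ _
𝔽₂[x]-ring = record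
  { Carrier = Poly ; _≈_ = _≋_ ; _+_ = _+P_ ; _*_ = _*P_ ; -_ = id ; 0# = [] ; 0≟_ = ≟[] ; 1# = oneP
  ; isAlmostCommutativeRing = record
    { isCommutativeSemiring = CommutativeSemiring.isCommutativeSemiring 𝔽₂[x]
    ; -‿cong = id
    ; -‿*-distribˡ = λ _ _ → ≋-refl
    ; -‿+-comm = λ _ _ → ≋-refl } }

open AlmostCommutativeRing 𝔽₂[x]-ring using (_^_; semiring)
open import Algebra.Properties.Semiring.Exp.TCOptimised semiring using (^-homo-*)

-- Divisibility and congruences

infix 4 _∣_
record _∣_ (d p : Poly) : Set where
  constructor divides
  field
    quotient : Poly
    equation : d *P quotient ≋ p

∣-refl : ∀ {d} → d ∣ d
∣-refl {d} = divides oneP (*P-identityʳ d)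

∣-respʳ : ∀ {d p q} → p ≋ q → d ∣ p → d ∣ q
∣-respʳ p≋q (divides r e) = divides r (≋-trans e p≋q)

∣-trans : ∀ {a b c} → a ∣ b → b ∣ c → a ∣ c
∣-trans {a} (divides q e) (divides r f) =
  divides (q *P r) (≋-trans (≋-sym (*P-assoc a q r)) (≋-trans (*P-congˡ r e) f))

∣-[] : ∀ {d} → d ∣ []
∣-[] {d} = divides [] (*P-zeroʳ d)

∣-+P : ∀ {d p q} → d ∣ p → d ∣ q → d ∣ p +P q
∣-+P {d} (divides u e) (divides v f) = divides (u +P v) (≋-trans (*P-distribˡ d u v) (+P-cong e f))

∣-*Pʳ : ∀ {d p} r → d ∣ p → d ∣ p *P r
∣-*Pʳ {d} r (divides u e) = divides (u *P r) (≋-trans (≋-sym (*P-assoc d u r)) (*P-congˡ r e))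

∣-*Pˡ : ∀ {d p} r → d ∣ p → d ∣ r *P p
∣-*Pˡ {p = p} r d∣p = ∣-respʳ (*P-comm p r) (∣-*Pʳ r d∣p)

∣-*P : ∀ {a b c d} → a ∣ b → c ∣ d → a *P c ∣ b *P d
∣-*P {a} {c = c} (divides q e) (divides r f) =
  divides (q *P r) (≋-trans (interchange a c q r) (*P-cong e f))
  where
  interchange : ∀ a c q r → (a *P c) *P (q *P r) ≋ (a *P q) *P (c *P r)
  interchange = solve-∀ 𝔽₂[x]-ring

Coprime : Poly → Poly → Set
Coprime a b = ∀ d → d ∣ a → d ∣ b → d ∣ oneP

-- Over 𝔽₂ the difference p − q is p + q.
infix 4 _≡_mod_
record _≡_mod_ (p q f : Poly) : Set where
  constructor mk≡mod
  field divides-sum : f ∣ p +P q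
open _≡_mod_ public

≋⇒≡mod : ∀ {f p q} → p ≋ q → p ≡ q mod f
≋⇒≡mod {p = p} p≋q = mk≡mod (∣-respʳ (≋-trans (≋-sym (+P-self p)) (+P-cong ≋-refl p≋q)) ∣-[])

≡mod-sym : ∀ {f p q} → p ≡ q mod f → q ≡ p mod f
≡mod-sym {p = p} {q} (mk≡mod f∣p+q) = mk≡mod (∣-respʳ (+P-comm p q) f∣p+q)

≡mod-trans : ∀ {f p q r} → p ≡ q mod f → q ≡ r mod f → p ≡ r mod f
≡mod-trans {p = p} {q} {r} (mk≡mod f∣p+q) (mk≡mod f∣q+r) =
  mk≡mod (∣-respʳ (cancel p q r) (∣-+P f∣p+q f∣q+r))
  where
  cancel : ∀ p q r → (p +P q) +P (q +P r) ≋ p +P r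
  cancel = solve-∀ 𝔽₂[x]-ring

≡mod-+P : ∀ {f p p′ q q′} → p ≡ p′ mod f → q ≡ q′ mod f → p +P q ≡ p′ +P q′ mod f
≡mod-+P {p = p} {p′} {q} {q′} (mk≡mod e) (mk≡mod e′) =
  mk≡mod (∣-respʳ (+P-interchange p p′ q q′) (∣-+P e e′))

≡mod-*P : ∀ {f p p′ q q′} → p ≡ p′ mod f → q ≡ q′ mod f → p *P q ≡ p′ *P q′ mod f
≡mod-*P {p = p} {p′} {q} {q′} (mk≡mod e) (mk≡mod e′) =
  mk≡mod (∣-respʳ (split p p′ q q′) (∣-+P (∣-*Pʳ q e) (∣-*Pˡ p′ e′)))
  where
  split : ∀ p p′ q q′ → (p +P p′) *P q +P p′ *P (q +P q′) ≋ p *P q +P p′ *P q′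
  split = solve-∀ 𝔽₂[x]-ring

≡mod-setoid : Poly → Setoid _ _
≡mod-setoid f = record
  { Carrier = Poly
  ; _≈_ = λ p q → p ≡ q mod f
  ; isEquivalence = record { refl = ≋⇒≡mod ≋-refl ; sym = ≡mod-sym ; trans = ≡mod-trans } }

≡mod-+Pˡ : ∀ {f p q} r → p ≡ q mod f → r +P p ≡ r +P q mod f
≡mod-+Pˡ r p≡q = ≡mod-+P (≋⇒≡mod (≋-refl {r})) p≡q

≡mod-+Pʳ : ∀ {f p q} r → p ≡ q mod f → p +P r ≡ q +P r mod f
≡mod-+Pʳ r p≡q = ≡mod-+P p≡q (≋⇒≡mod (≋-refl {r}))

≡mod-*Pˡ : ∀ {f p q} r → p ≡ q mod f → r *P p ≡ r *P q mod f
≡mod-*Pˡ r p≡q = ≡mod-*P (≋⇒≡mod (≋-refl {r})) p≡q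

-- The binomials x^a − 1

X^-+ : ∀ a b → X^ (a + b) ≋ X^ a *P X^ b
X^-+ zero    b = ≋-sym (*P-identityˡ (X^ b))
X^-+ (suc a) b = ≋-cons (X^-+ a b)

X^-* : ∀ n a → X^ (n * a) ≋ X^ a ^ n
X^-* zero    a = ≋-refl
X^-* (suc n) a =
  ≋-trans (X^-+ a (n * a)) (≋-trans (*P-congʳ (X^ a) (X^-* n a)) (≋-sym (^-homo-* (X^ a) 1 n)))

xm-1-+ : ∀ a b → xm-1 (a + b) ≋ xm-1 a +P X^ a *P xm-1 b
xm-1-+ a b = ≋-trans (+P-cong (X^-+ a b) ≋-refl) (identity (X^ a) (X^ b))
  where
  identity : ∀ x y → x *P y +P oneP ≋ (x +P oneP) +P x *P (y +P oneP)
  identity = solve-∀ 𝔽₂[x]-ring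

xm-1[0]≋[] : xm-1 0 ≋ []
xm-1[0]≋[] = false∷[]≋[]

∣⇒xm-1∣xm-1 : ∀ {a b} → a ℕᵈ.∣ b → xm-1 a ∣ xm-1 b
∣⇒xm-1∣xm-1         (ℕᵈ.divides zero    refl) = ∣-respʳ (≋-sym xm-1[0]≋[]) ∣-[]
∣⇒xm-1∣xm-1 {a} (ℕᵈ.divides (suc n) refl) =
  ∣-respʳ (≋-sym (xm-1-+ a (n * a))) (∣-+P ∣-refl (∣-*Pˡ (X^ a) (∣⇒xm-1∣xm-1 (ℕᵈ.divides n refl))))

xm-1[4*a]≋xm-1⁴ : ∀ a → xm-1 (4 * a) ≋ xm-1 a ^ 4
xm-1[4*a]≋xm-1⁴ a = ≋-trans (+P-cong (X^-* 4 a) ≋-refl) (frobenius (X^ a))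
  where
  frobenius : ∀ x → x ^ 4 +P oneP ≋ (x +P oneP) ^ 4
  frobenius = solve-∀ 𝔽₂[x]-ring

xm-1-bézout-step : ∀ {a b g s t} → g + t ≡ s → xm-1 a ∣ xm-1 s → xm-1 b ∣ xm-1 t →
                   ∃₂ λ u v → u *P xm-1 a +P v *P xm-1 b ≋ xm-1 g
xm-1-bézout-step {a} {b} {g} {t = t} refl (divides q e) (divides r f) = q , X^ g *P r , (begin
  q *P xm-1 a +P (X^ g *P r) *P xm-1 b          ≈⟨ +P-cong (*P-comm q _) (rearrange (X^ g) r (xm-1 b)) ⟩
  xm-1 a *P q +P X^ g *P (xm-1 b *P r)          ≈⟨ +P-cong e (*P-congʳ (X^ g) f) ⟩
  xm-1 (g + t) +P X^ g *P xm-1 t                ≈⟨ +P-cong (xm-1-+ g t) ≋-refl ⟩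
  (xm-1 g +P X^ g *P xm-1 t) +P X^ g *P xm-1 t  ≈⟨ cancel (xm-1 g) (X^ g *P xm-1 t) ⟩
  xm-1 g                                        ∎)
  where
  open ≈-Reasoning ≋-setoid
  rearrange : ∀ x r e → (x *P r) *P e ≋ x *P (e *P r)
  rearrange = solve-∀ 𝔽₂[x]-ring
  cancel : ∀ p q → (p +P q) +P q ≋ p
  cancel = solve-∀ 𝔽₂[x]-ring

xm-1-bézout : ∀ a b → ∃₂ λ u v → u *P xm-1 a +P v *P xm-1 b ≋ xm-1 (gcd a b)
xm-1-bézout a b with ℕ-Bézout.identity (gcd-GCD a b)
... | ℕ-Bézout.+- x y eq = xm-1-bézout-step eq (∣⇒xm-1∣xm-1 (ℕᵈ.n∣m*n x)) (∣⇒xm-1∣xm-1 (ℕᵈ.n∣m*n y))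
... | ℕ-Bézout.-+ x y eq
  with u , v , e ← xm-1-bézout-step eq (∣⇒xm-1∣xm-1 (ℕᵈ.n∣m*n y)) (∣⇒xm-1∣xm-1 (ℕᵈ.n∣m*n x))
  = v , u , ≋-trans (+P-comm (v *P xm-1 a) _) e

∣xm-1∧∣xm-1*⇒∣xm-1[gcd]* : ∀ {d a b} z → d ∣ xm-1 a → d ∣ xm-1 b *P z → d ∣ xm-1 (gcd a b) *P z
∣xm-1∧∣xm-1*⇒∣xm-1[gcd]* {d} {a} {b} z d∣xa d∣xbz with u , v , e ← xm-1-bézout a b =
  ∣-respʳ (≋-trans (expand u v (xm-1 a) (xm-1 b) z) (*P-congˡ z e))
          (∣-+P (∣-*Pˡ (u *P z) d∣xa) (∣-*Pˡ v d∣xbz))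
  where
  expand : ∀ u v p q z → (u *P z) *P p +P v *P (q *P z) ≋ (u *P p +P v *P q) *P z
  expand = solve-∀ 𝔽₂[x]-ring

xm-1∣X^*⇒xm-1∣ : ∀ {g} N p → 1 ≤ g → xm-1 g ∣ X^ N *P p → xm-1 g ∣ p
xm-1∣X^*⇒xm-1∣ {suc g} N p _ g∣xp =
  ∣-respʳ (≋-trans (+P-cong ≋-refl (*P-congˡ p (+P-cong (X^-+ N (g * N)) ≋-refl)))
                   (identity (X^ N) (X^ (g * N)) p))
          (∣-+P (∣-*Pˡ (X^ (g * N)) g∣xp) (∣-*Pʳ p (∣⇒xm-1∣xm-1 (ℕᵈ.m∣m*n {suc g} N))))
  where
  identity : ∀ x w p → w *P (x *P p) +P (x *P w +P oneP) *P p ≋ p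
  identity = solve-∀ 𝔽₂[x]-ring

coeff-≥length : ∀ p {n} → length p ≤ n → coeff p n ≡ false
coeff-≥length []      _         = refl
coeff-≥length (a ∷ p) (s≤s len) = coeff-≥length p len

coeff-X^-≢ : ∀ r {n} → n ≢ r → coeff (X^ r) n ≡ false
coeff-X^-≢ zero    {zero}  n≢r = ⊥-elim (n≢r refl)
coeff-X^-≢ zero    {suc n} n≢r = refl
coeff-X^-≢ (suc r) {zero}  n≢r = refl
coeff-X^-≢ (suc r) {suc n} n≢r = coeff-X^-≢ r (n≢r ∘ cong suc)

coeff-X^*P : ∀ a q i → coeff (X^ a *P q) (a + i) ≡ coeff q i
coeff-X^*P zero    q i = coeff-≡ (*P-identityˡ q) i
coeff-X^*P (suc a) q i = coeff-X^*P a q i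

xor≡false⇒≡ : ∀ {x y} → x xor y ≡ false → x ≡ y
xor≡false⇒≡ {false} {false} _ = refl
xor≡false⇒≡ {true}  {true}  _ = refl

-- From (x^a + 1) q = x^r + 1 with 0 < r < a, the coefficients of q at all multiples of a are 1.
xm-1∤xm-1 : ∀ {a r} → 1 ≤ r → r < a → ¬ xm-1 a ∣ xm-1 r
xm-1∤xm-1 {suc a′} {suc r′} _ r<a (divides q e) =
  true≢false (≡.trans (≡.sym (coeff-[j*a] (length q))) (coeff-≥length q (ℕ.m≤m*n (length q) a)))
  where
  true≢false : true ≢ false
  true≢false ()
  open ≡.≡-Reasoning
  a = suc a′
  r = suc r′
  relation : ∀ n → coeff (X^ a *P q) n xor coeff q n ≡ coeff (xm-1 r) n
  relation n = begin
    coeff (X^ a *P q) n xor coeff q n             ≡⟨ cong (coeff (X^ a *P q) n xor_) (coeff-≡ (*P-identityˡ q) n) ⟨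
    coeff (X^ a *P q) n xor coeff (oneP *P q) n   ≡⟨ coeff-+ (X^ a *P q) (oneP *P q) n ⟨
    coeff (X^ a *P q +P oneP *P q) n              ≡⟨ coeff-≡ (≋-trans (≋-sym (*P-distribʳ (X^ a) oneP q)) e) n ⟩
    coeff (xm-1 r) n                              ∎
  coeff-[j*a] : ∀ j → coeff q (j * a) ≡ true
  coeff-[j*a] zero    = relation 0
  coeff-[j*a] (suc j) = ≡.trans (≡.sym (xor≡false⇒≡ (begin
    coeff q (j * a) xor coeff q (a + j * a)             ≡⟨ cong (_xor coeff q (a + j * a)) (coeff-X^*P a q (j * a)) ⟨
    coeff (X^ a *P q) (a + j * a) xor coeff q (a + j * a) ≡⟨ relation (a + j * a) ⟩
    coeff (xm-1 r) (a + j * a)                          ≡⟨ coeff-+ (X^ r) oneP (a + j * a) ⟩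
    coeff (X^ r) (a + j * a) xor false                  ≡⟨ cong (_xor false) (coeff-X^-≢ r a+ja≢r) ⟩
    false                                               ∎))) (coeff-[j*a] j)
    where
    a+ja≢r : a + j * a ≢ r
    a+ja≢r eq = ℕ.<⇒≢ (ℕ.<-≤-trans r<a (ℕ.m≤m+n a (j * a))) (≡.sym eq)

xm-1∣xm-1⇒∣ : ∀ {a b} → 1 ≤ a → xm-1 a ∣ xm-1 b → a ℕᵈ.∣ b
xm-1∣xm-1⇒∣ {suc a′} {b} _ a∣b with b % suc a′ | m≡m%n+[m/n]*n b (suc a′) | m%n<n b (suc a′)
... | zero  | eq | _   = ℕᵈ.divides (b / suc a′) eq
... | suc r | eq | r<a = ⊥-elim (xm-1∤xm-1 (s≤s z≤n) r<a a∣xm-1[r+1])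
  where
  N = b / suc a′ * suc a′
  cancel : ∀ p q → (p +P q) +P q ≋ p
  cancel = solve-∀ 𝔽₂[x]-ring
  a∣xm-1[r+1] : xm-1 (suc a′) ∣ xm-1 (suc r)
  a∣xm-1[r+1] = ∣-respʳ (≋-trans (+P-cong (≋-trans (≋-reflexive (cong xm-1 eq)) (xm-1-+ (suc r) N)) ≋-refl)
                                 (cancel (xm-1 (suc r)) (X^ (suc r) *P xm-1 N)))
                        (∣-+P a∣b (∣-*Pˡ (X^ (suc r)) (∣⇒xm-1∣xm-1 (ℕᵈ.n∣m*n (b / suc a′)))))

-- Euclid's algorithm

∷ʳ-≋ : ∀ l t → l ∷ʳ t ≋ l +P scale t (X^ (length l))
∷ʳ-≋ []      true  = ≋-refl
∷ʳ-≋ []      false = false∷[]≋[]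
∷ʳ-≋ (a ∷ l) true  = mk≋ λ where
  zero    → ≡.sym (xor-identityʳ a)
  (suc n) → coeff-≡ (∷ʳ-≋ l true) n
∷ʳ-≋ (a ∷ l) false = ≋-cons (≋-trans (∷ʳ-≋ l false) (+P-identityʳ l))

monic : List Bool → Poly
monic bs = bs ∷ʳ true

zero-or-monic : ∀ p → p ≋ [] ⊎ ∃ λ bs → p ≋ monic bs × length bs < length p
zero-or-monic []          = inj₁ ≋-refl
zero-or-monic (a ∷ p) with zero-or-monic p
zero-or-monic (true ∷ p)  | inj₁ p≋[]            = inj₂ ([] , ≋-cons p≋[] , s≤s z≤n)
zero-or-monic (false ∷ p) | inj₁ p≋[]            = inj₁ (≋-trans (≋-cons p≋[]) false∷[]≋[])
zero-or-monic (a ∷ p)     | inj₂ (bs , p≋ , len) = inj₂ (a ∷ bs , ≋-cons p≋ , s≤s len)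

replicate-false≋[] : ∀ n → replicate n false ≋ []
replicate-false≋[] zero    = ≋-refl
replicate-false≋[] (suc n) = ≋-trans (≋-cons (replicate-false≋[] n)) false∷[]≋[]

splitLast : ∀ (a : Bool) r → ∃₂ λ l t → a ∷ r ≡ l ∷ʳ t
splitLast a []      = [] , a , refl
splitLast a (b ∷ r) with l , t , eq ← splitLast b r = a ∷ l , t , cong (a ∷_) eq

length-init : ∀ {a : Bool} {r l t} → a ∷ r ≡ l ∷ʳ t → length l ≡ length r
length-init {l = l} eq =
  ℕ.suc-injective (≡.trans (≡.trans (ℕ.+-comm 1 (length l)) (≡.sym (length-++ l))) (≡.sym (cong length eq)))

length-+P : ∀ p q → length q ≤ length p → length (p +P q) ≡ length p
length-+P []      []      _         = refl
length-+P (a ∷ p) []      _         = refl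
length-+P (a ∷ p) (b ∷ q) (s≤s len) = cong suc (length-+P p q len)

length-scale : ∀ t p → length (scale t p) ≤ length p
length-scale true  p = ℕ.≤-refl
length-scale false p = z≤n

X^≋monic+P : ∀ bs → X^ (length bs) ≋ monic bs +P bs
X^≋monic+P bs = ≋-trans (≋-sym (cancel bs _)) (+P-cong (≋-sym (∷ʳ-≋ bs true)) ≋-refl)
  where
  cancel : ∀ p q → (p +P q) +P p ≋ q
  cancel = solve-∀ 𝔽₂[x]-ring

record DivMod (a : Poly) (bs : List Bool) : Set where
  constructor mkDivMod
  field
    quotient remainder : Poly
    length-remainder   : length remainder ≡ length bs
    equation           : a ≋ quotient *P monic bs +P remainder

divMod : ∀ a bs → DivMod a bs
divMod []       bs = mkDivMod [] (replicate (length bs) false) (length-replicate (length bs))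
                       (≋-sym (replicate-false≋[] (length bs)))
divMod (a ∷ a′) bs with divMod a′ bs
... | mkDivMod q r len e with splitLast a r
... | l , t , eq = mkDivMod (t ∷ q) (l +P scale t bs) length-remainder (begin
    a ∷ a′                                             ≈⟨ unshift ⟩
    (a ∷ r) +P (false ∷ q *P b)                        ≈⟨ +P-cong (≋-trans (≋-reflexive eq) (∷ʳ-≋ l t)) ≋-refl ⟩
    (l +P scale t (X^ (length l))) +P (false ∷ q *P b) ≈⟨ +P-cong (+P-cong (≋-refl {l}) top) ≋-refl ⟩
    (l +P (scale t b +P scale t bs)) +P (false ∷ q *P b) ≈⟨ rearrange l (scale t b) (scale t bs) _ ⟩
    (scale t b +P (false ∷ q *P b)) +P (l +P scale t bs) ∎)
  where
  open ≈-Reasoning ≋-setoid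
  b = monic bs
  length-l : length l ≡ length bs
  length-l = ≡.trans (length-init eq) len
  length-remainder : length (l +P scale t bs) ≡ length bs
  length-remainder = ≡.trans (length-+P l (scale t bs) (ℕ.≤-trans (length-scale t bs) (ℕ.≤-reflexive (≡.sym length-l)))) length-l
  unshift : a ∷ a′ ≋ (a ∷ r) +P (false ∷ q *P b)
  unshift = mk≋ λ where
    zero    → ≡.sym (xor-identityʳ a)
    (suc n) → coeff-≡ (≋-trans e (+P-comm (q *P b) r)) n
  top : scale t (X^ (length l)) ≋ scale t b +P scale t bs
  top = ≋-trans (scale-cong t (≋-trans (≋-reflexive (cong X^ length-l)) (X^≋monic+P bs))) (scale-+P t b bs)
    where
    scale-cong : ∀ t {p q} → p ≋ q → scale t p ≋ scale t q
    scale-cong true  p≋q = p≋q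
    scale-cong false _   = ≋-refl
  rearrange : ∀ l x y s → (l +P (x +P y)) +P s ≋ (x +P s) +P (l +P y)
  rearrange = solve-∀ 𝔽₂[x]-ring

record Bézout (a b : Poly) : Set where
  constructor mkBézout
  field
    g u v    : Poly
    g∣a      : g ∣ a
    g∣b      : g ∣ b
    identity : u *P a +P v *P b ≋ g

bézout-monic : ∀ n bs → length bs < n → ∀ a → Bézout a (monic bs)
bézout-monic (suc n) bs (s≤s len<n) a with divMod a bs
... | mkDivMod q r len-r a≋ with zero-or-monic r
...   | inj₁ r≋[] = mkBézout (monic bs) [] oneP b∣a ∣-refl (*P-identityˡ (monic bs))
  where
  b∣a : monic bs ∣ a
  b∣a = divides q (≋-sym (≋-trans a≋ (≋-trans (+P-cong (*P-comm q (monic bs)) r≋[]) (+P-identityʳ _))))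
...   | inj₂ (bs′ , r≋ , len′) with bézout-monic n bs′ (ℕ.≤-trans len′ (ℕ.≤-trans (ℕ.≤-reflexive len-r) len<n)) (monic bs)
...     | mkBézout g u v g∣b g∣r identity = mkBézout g v (u +P v *P q) g∣a g∣b (begin
  v *P a +P (u +P v *P q) *P b              ≈⟨ +P-cong (*P-congʳ v a≋) ≋-refl ⟩
  v *P (q *P b +P r) +P (u +P v *P q) *P b  ≈⟨ regroup v q b r u ⟩
  u *P b +P v *P r                          ≈⟨ +P-cong ≋-refl (*P-congʳ v r≋) ⟩
  u *P b +P v *P monic bs′                  ≈⟨ identity ⟩
  g                                         ∎)
  where
  open ≈-Reasoning ≋-setoid
  b = monic bs
  g∣a : g ∣ a
  g∣a = ∣-respʳ (≋-sym a≋) (∣-+P (∣-*Pˡ q g∣b) (∣-respʳ (≋-sym r≋) g∣r))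
  regroup : ∀ v q b r u → v *P (q *P b +P r) +P (u +P v *P q) *P b ≋ u *P b +P v *P r
  regroup = solve-∀ 𝔽₂[x]-ring

bézout : ∀ a b → Bézout a b
bézout a b with zero-or-monic b
... | inj₁ b≋[] = mkBézout a oneP [] ∣-refl (∣-respʳ (≋-sym b≋[]) ∣-[]) (≋-trans (+P-identityʳ _) (*P-identityˡ a))
... | inj₂ (bs , b≋ , _) with bézout-monic (suc (length bs)) bs ℕ.≤-refl a
...   | mkBézout g u v g∣a g∣b identity =
  mkBézout g u v g∣a (∣-respʳ (≋-sym b≋) g∣b) (≋-trans (+P-cong (≋-refl {u *P a}) (*P-congʳ v b≋)) identity)

coprime-divisor : ∀ {a b} z → Coprime a b → b ∣ a *P z → b ∣ z
coprime-divisor {a} {b} z coprime b∣az with bézout a b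
... | mkBézout g u v g∣a g∣b identity with divides w gw≋1 ← coprime g g∣a g∣b =
  ∣-respʳ (begin
    (u *P w) *P (a *P z) +P b *P (v *P w *P z) ≈⟨ regroup u w a z b v ⟩
    ((u *P a +P v *P b) *P w) *P z             ≈⟨ *P-congˡ z (*P-congˡ w identity) ⟩
    (g *P w) *P z                              ≈⟨ *P-congˡ z gw≋1 ⟩
    oneP *P z                                  ≈⟨ *P-identityˡ z ⟩
    z                                          ∎)
    (∣-+P (∣-*Pˡ (u *P w) b∣az) (∣-*Pʳ (v *P w *P z) ∣-refl))
  where
  open ≈-Reasoning ≋-setoid
  regroup : ∀ u w a z b v → (u *P w) *P (a *P z) +P b *P (v *P w *P z) ≋ ((u *P a +P v *P b) *P w) *P z
  regroup = solve-∀ 𝔽₂[x]-ring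

-- The key congruence

2[1+n]∸1≡1+2n : ∀ n → 2 * suc n ∸ 1 ≡ 1 + 2 * n
2[1+n]∸1≡1+2n n = cong (_∸ 1) 2[1+n]≡2+2n
  where
  2[1+n]≡2+2n : 2 * suc n ≡ 2 + 2 * n
  2[1+n]≡2+2n = ℕ-Solver.solve (n ∷ [])

module KeyCongruence (m k : ℕ) where

  y : Poly
  y = X^ k

  Y : ℕ → Poly
  Y n = X^ (n * k)

  pair : ℕ → Poly
  pair j = Y j +P X^ ((m ∸ j) * k)

  Y-split : ∀ {e} a b → e ≡ a + b → Y e ≋ Y a *P y ^ b
  Y-split {e} a b refl = begin
    X^ ((a + b) * k)        ≡⟨ cong X^ (ℕ.*-distribʳ-+ k a b) ⟩
    X^ (a * k + b * k)      ≈⟨ X^-+ (a * k) (b * k) ⟩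
    Y a *P X^ (b * k)       ≈⟨ *P-congʳ (Y a) (X^-* b k) ⟩
    Y a *P y ^ b            ∎
    where open ≈-Reasoning ≋-setoid

  Y≋y^ : ∀ n → Y n ≋ y ^ n
  Y≋y^ n = X^-* n k

  Y-mirror : ∀ j → j ≤ m → Y j *P X^ ((m ∸ j) * k) ≡ oneP mod xm-1 m
  Y-mirror j j≤m = mk≡mod (∣-respʳ (+P-cong (≋-sym product) ≋-refl) (∣⇒xm-1∣xm-1 (ℕᵈ.m∣m*n k)))
    where
    product : Y j *P X^ ((m ∸ j) * k) ≋ X^ (m * k)
    product = begin
      X^ (j * k) *P X^ ((m ∸ j) * k) ≈⟨ X^-+ (j * k) _ ⟨
      X^ (j * k + (m ∸ j) * k)       ≡⟨ cong X^ (ℕ.*-distribʳ-+ k j (m ∸ j)) ⟨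
      X^ ((j + (m ∸ j)) * k)         ≡⟨ cong (λ e → X^ (e * k)) (ℕ.m+[n∸m]≡n j≤m) ⟩
      X^ (m * k)                     ∎
      where open ≈-Reasoning ≋-setoid

  evenPairs : ℕ → Poly
  evenPairs n = sumP (map pair (map (λ i → 2 * (i + 2)) (upTo n)))

  evenPairs-suc : ∀ n → evenPairs (suc n) ≋ evenPairs n +P pair (2 * (n + 2))
  evenPairs-suc n =
    ≋-trans (≋-reflexive (cong (λ is → sumP (map pair (map (λ i → 2 * (i + 2)) is))) (≡.sym (upTo-∷ʳ n))))
            (snoc (upTo n))
    where
    snoc : ∀ is → sumP (map pair (map (λ i → 2 * (i + 2)) (is ∷ʳ n)))
                  ≋ sumP (map pair (map (λ i → 2 * (i + 2)) is)) +P pair (2 * (n + 2))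
    snoc []       = +P-identityʳ _
    snoc (i ∷ is) = ≋-trans (+P-cong (≋-refl {pair (2 * (i + 2))}) (snoc is))
                            (≋-sym (+P-assoc (pair (2 * (i + 2))) _ (pair (2 * (n + 2)))))

  -- (y² + 1) Σ_{i=2}^{n+1} (y^{2i} + y^{−2i}) = y^{2n+4} + y^4 + y^{−2} + y^{−2n−2}; multiply by y^{2n+2}.
  evenPairs-telescope : ∀ n → 2 * n + 2 ≤ m →
    (y ^ 2 +P oneP) *P ((Y (2 * n) *P y ^ 2) *P evenPairs n)
      ≡ (Y (2 * n) +P oneP) *P (Y (2 * n) *P y ^ 6 +P oneP) mod xm-1 m
  evenPairs-telescope zero    _     = ≋⇒≡mod (begin
    (y ^ 2 +P oneP) *P ((oneP *P y ^ 2) *P [])  ≈⟨ *P-congʳ (y ^ 2 +P oneP) (*P-zeroʳ (oneP *P y ^ 2)) ⟩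
    (y ^ 2 +P oneP) *P []                       ≈⟨ *P-zeroʳ (y ^ 2 +P oneP) ⟩
    []                                          ≈⟨ *P-annihilatedˡ (oneP +P oneP) (oneP *P y ^ 6 +P oneP) false∷[]≋[] ⟨
    (oneP +P oneP) *P (oneP *P y ^ 6 +P oneP)   ∎)
    where open ≈-Reasoning ≋-setoid
  evenPairs-telescope (suc n) bound = begin
    (y ^ 2 +P oneP) *P ((Y (2 * suc n) *P y ^ 2) *P evenPairs (suc n))
      ≈⟨ ≋⇒≡mod (*P-congʳ (y ^ 2 +P oneP) (*P-cong (*P-congˡ (y ^ 2) v′≋) (evenPairs-suc n))) ⟩
    (y ^ 2 +P oneP) *P (((v *P y ^ 2) *P y ^ 2) *P (E +P (u +P w)))
      ≈⟨ ≋⇒≡mod (*P-congʳ (y ^ 2 +P oneP) (*P-congʳ ((v *P y ^ 2) *P y ^ 2) (+P-cong (≋-refl {E}) (+P-cong u≋ (≋-refl {w}))))) ⟩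
    (y ^ 2 +P oneP) *P (((v *P y ^ 2) *P y ^ 2) *P (E +P (v *P y ^ 4 +P w)))
      ≈⟨ ≋⇒≡mod (distribute y v E w) ⟩
    y ^ 2 *P ((y ^ 2 +P oneP) *P ((v *P y ^ 2) *P E))
      +P (y ^ 2 +P oneP) *P ((v *P y ^ 4) *P (v *P y ^ 4))
      +P (y ^ 2 +P oneP) *P ((v *P y ^ 4) *P w)
      ≈⟨ ≡mod-+P (≡mod-+Pʳ _ (≡mod-*Pˡ (y ^ 2) (evenPairs-telescope n IH-bound)))
                 (≡mod-*Pˡ (y ^ 2 +P oneP) u-mirror) ⟩
    y ^ 2 *P ((v +P oneP) *P (v *P y ^ 6 +P oneP))
      +P (y ^ 2 +P oneP) *P ((v *P y ^ 4) *P (v *P y ^ 4))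
      +P (y ^ 2 +P oneP) *P oneP
      ≈⟨ ≋⇒≡mod (collect y v) ⟩
    (v *P y ^ 2 +P oneP) *P ((v *P y ^ 2) *P y ^ 6 +P oneP)
      ≈⟨ ≋⇒≡mod (≋-sym (*P-cong (+P-cong v′≋ ≋-refl) (+P-cong (*P-congˡ (y ^ 6) v′≋) ≋-refl))) ⟩
    (Y (2 * suc n) +P oneP) *P (Y (2 * suc n) *P y ^ 6 +P oneP)
      ∎
    where
    open ≈-Reasoning (≡mod-setoid (xm-1 m))
    v = Y (2 * n)
    u = Y (2 * (n + 2))
    w = X^ ((m ∸ 2 * (n + 2)) * k)
    E = evenPairs n
    bound-eq : 2 * n + 2 + 2 ≡ 2 * suc n + 2
    bound-eq = ℕ-Solver.solve (n ∷ [])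
    u-bound-eq : 2 * (n + 2) ≡ 2 * suc n + 2
    u-bound-eq = ℕ-Solver.solve (n ∷ [])
    IH-bound : 2 * n + 2 ≤ m
    IH-bound = ℕ.≤-trans (ℕ.m≤m+n _ 2) (ℕ.≤-trans (ℕ.≤-reflexive bound-eq) bound)
    u-bound : 2 * (n + 2) ≤ m
    u-bound = ℕ.≤-trans (ℕ.≤-reflexive u-bound-eq) bound
    v′≋ : Y (2 * suc n) ≋ v *P y ^ 2
    v′≋ = Y-split {2 * suc n} (2 * n) 2 (ℕ-Solver.solve (n ∷ []))
    u≋ : u ≋ v *P y ^ 4
    u≋ = Y-split {2 * (n + 2)} (2 * n) 4 (ℕ-Solver.solve (n ∷ []))
    u-mirror : (v *P y ^ 4) *P w ≡ oneP mod xm-1 m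
    u-mirror = ≡mod-trans (≋⇒≡mod (*P-congˡ w (≋-sym u≋))) (Y-mirror (2 * (n + 2)) u-bound)
    distribute : ∀ y v E w →
      (y ^ 2 +P oneP) *P (((v *P y ^ 2) *P y ^ 2) *P (E +P (v *P y ^ 4 +P w)))
        ≋ y ^ 2 *P ((y ^ 2 +P oneP) *P ((v *P y ^ 2) *P E))
          +P (y ^ 2 +P oneP) *P ((v *P y ^ 4) *P (v *P y ^ 4))
          +P (y ^ 2 +P oneP) *P ((v *P y ^ 4) *P w)
    distribute = solve-∀ 𝔽₂[x]-ring
    collect : ∀ y v →
      y ^ 2 *P ((v +P oneP) *P (v *P y ^ 6 +P oneP))
        +P (y ^ 2 +P oneP) *P ((v *P y ^ 4) *P (v *P y ^ 4))
        +P (y ^ 2 +P oneP) *P oneP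
        ≋ (v *P y ^ 2 +P oneP) *P ((v *P y ^ 2) *P y ^ 6 +P oneP)
    collect = solve-∀ 𝔽₂[x]-ring

  key-congruence : ∀ t → 1 ≤ t → 2 * t + 1 ≤ m →
    (Y (2 * t + 1) *P cOfXk m k t) *P xm-1 k ^ 3
      ≡ xm-1 ((2 * t + 3) * k) *P xm-1 ((2 * t ∸ 1) * k) *P xm-1 (3 * k) mod xm-1 m
  key-congruence (suc n) _ bound = begin
    (Y (2 * suc n + 1) *P (oneP +P (pair 1 +P (pair (2 * suc n + 1) +P E)))) *P (y +P oneP) ^ 3
      ≈⟨ ≋⇒≡mod (*P-congˡ ((y +P oneP) ^ 3) (*P-cong Ys≋ (+P-cong (≋-refl {oneP})
           (+P-cong (+P-cong (Y≋y^ 1) (≋-refl {w₁})) (+P-cong (+P-cong Ys≋ (≋-refl {wₛ})) (≋-refl {E})))))) ⟩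
    ((v *P y ^ 3) *P (oneP +P ((y +P w₁) +P ((v *P y ^ 3 +P wₛ) +P E)))) *P (y +P oneP) ^ 3
      ≈⟨ ≋⇒≡mod (expand y v w₁ wₛ E) ⟩
    (y +P oneP) ^ 3 *P (v *P y ^ 3 +P v *P y ^ 4 +P (v *P y ^ 2) *P (y *P w₁)
                        +P (v *P y ^ 3) *P (v *P y ^ 3) +P (v *P y ^ 3) *P wₛ)
      +P ((y +P oneP) *P y) *P ((y ^ 2 +P oneP) *P ((v *P y ^ 2) *P E))
      ≈⟨ ≡mod-+P (≡mod-*Pˡ ((y +P oneP) ^ 3)
                   (≡mod-+P (≡mod-+Pʳ ((v *P y ^ 3) *P (v *P y ^ 3))
                              (≡mod-+Pˡ (v *P y ^ 3 +P v *P y ^ 4) (≡mod-*Pˡ (v *P y ^ 2) mirror₁)))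
                            mirrorₛ))
                 (≡mod-*Pˡ ((y +P oneP) *P y) (evenPairs-telescope n telescope-bound)) ⟩
    (y +P oneP) ^ 3 *P (v *P y ^ 3 +P v *P y ^ 4 +P (v *P y ^ 2) *P oneP
                        +P (v *P y ^ 3) *P (v *P y ^ 3) +P oneP)
      +P ((y +P oneP) *P y) *P ((v +P oneP) *P (v *P y ^ 6 +P oneP))
      ≈⟨ ≋⇒≡mod (factor y v) ⟩
    (v *P y ^ 5 +P oneP) *P (v *P y +P oneP) *P (y ^ 3 +P oneP)
      ≈⟨ ≋⇒≡mod (≋-sym (*P-cong (*P-cong (+P-cong Y[s+2]≋ ≋-refl) (+P-cong Y[s-2]≋ ≋-refl)) (+P-cong (Y≋y^ 3) ≋-refl))) ⟩
    xm-1 ((2 * suc n + 3) * k) *P xm-1 ((2 * suc n ∸ 1) * k) *P xm-1 (3 * k)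
      ∎
    where
    open ≈-Reasoning (≡mod-setoid (xm-1 m))
    s = 2 * suc n + 1
    v = Y (2 * n)
    w₁ = X^ ((m ∸ 1) * k)
    wₛ = X^ ((m ∸ s) * k)
    E = evenPairs n
    Ys≋ : Y s ≋ v *P y ^ 3
    Ys≋ = Y-split {2 * suc n + 1} (2 * n) 3 (ℕ-Solver.solve (n ∷ []))
    Y[s+2]≋ : Y (2 * suc n + 3) ≋ v *P y ^ 5
    Y[s+2]≋ = Y-split {2 * suc n + 3} (2 * n) 5 (ℕ-Solver.solve (n ∷ []))
    Y[s-2]≋ : Y (2 * suc n ∸ 1) ≋ v *P y ^ 1
    Y[s-2]≋ = Y-split {2 * suc n ∸ 1} (2 * n) 1 (≡.trans (2[1+n]∸1≡1+2n n) (ℕ.+-comm 1 (2 * n)))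
    mirror₁ : y *P w₁ ≡ oneP mod xm-1 m
    mirror₁ = ≡mod-trans (≋⇒≡mod (*P-congˡ w₁ (≋-sym (Y≋y^ 1)))) (Y-mirror 1 (ℕ.≤-trans (ℕ.m≤n+m 1 (2 * suc n)) bound))
    mirrorₛ : (v *P y ^ 3) *P wₛ ≡ oneP mod xm-1 m
    mirrorₛ = ≡mod-trans (≋⇒≡mod (*P-congˡ wₛ (≋-sym Ys≋))) (Y-mirror s bound)
    telescope-bound : 2 * n + 2 ≤ m
    telescope-bound = ℕ.≤-trans (ℕ.m≤m+n _ 1) (ℕ.≤-trans (ℕ.≤-reflexive s≡) bound)
      where
      s≡ : 2 * n + 2 + 1 ≡ 2 * suc n + 1
      s≡ = ℕ-Solver.solve (n ∷ [])
    expand : ∀ y v w₁ wₛ E →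
      ((v *P y ^ 3) *P (oneP +P ((y +P w₁) +P ((v *P y ^ 3 +P wₛ) +P E)))) *P (y +P oneP) ^ 3
        ≋ (y +P oneP) ^ 3 *P (v *P y ^ 3 +P v *P y ^ 4 +P (v *P y ^ 2) *P (y *P w₁)
                              +P (v *P y ^ 3) *P (v *P y ^ 3) +P (v *P y ^ 3) *P wₛ)
          +P ((y +P oneP) *P y) *P ((y ^ 2 +P oneP) *P ((v *P y ^ 2) *P E))
    expand = solve-∀ 𝔽₂[x]-ring
    factor : ∀ y v →
      (y +P oneP) ^ 3 *P (v *P y ^ 3 +P v *P y ^ 4 +P (v *P y ^ 2) *P oneP
                          +P (v *P y ^ 3) *P (v *P y ^ 3) +P oneP)
        +P ((y +P oneP) *P y) *P ((v +P oneP) *P (v *P y ^ 6 +P oneP))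
        ≋ (v *P y ^ 5 +P oneP) *P (v *P y +P oneP) *P (y ^ 3 +P oneP)
    factor = solve-∀ 𝔽₂[x]-ring

  X^[a*k]≡1 : ∀ a → X^ (a * k) ≡ oneP mod xm-1 k
  X^[a*k]≡1 a = mk≡mod (∣⇒xm-1∣xm-1 (ℕᵈ.n∣m*n a))

  cOfXk≡1 : ∀ t → cOfXk m k t ≡ oneP mod xm-1 k
  cOfXk≡1 t = ≡mod-trans (≡mod-+Pˡ oneP (pairs≡[] (indexSet t))) (≋⇒≡mod (+P-identityʳ oneP))
    where
    pairs≡[] : ∀ js → sumP (map pair js) ≡ [] mod xm-1 k
    pairs≡[] []       = ≋⇒≡mod ≋-refl
    pairs≡[] (j ∷ js) = ≡mod-+P (≡mod-trans (≡mod-+P (X^[a*k]≡1 j) (X^[a*k]≡1 (m ∸ j))) (≋⇒≡mod (+P-self oneP)))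
                                (pairs≡[] js)

-- The two directions

∣⇒∣P : ∀ {d p} → d ∣ p → d ∣P p
∣⇒∣P (divides q e) = q , coeff-≡ e

∣P⇒∣ : ∀ {d p} → d ∣P p → d ∣ p
∣P⇒∣ (q , e) = divides q (mk≋ e)

Coprime⇒CoprimeP : ∀ {a b} → Coprime a b → CoprimeP a b
Coprime⇒CoprimeP coprime d d∣a d∣b = ∣⇒∣P (coprime d (∣P⇒∣ d∣a) (∣P⇒∣ d∣b))

CoprimeP⇒Coprime : ∀ {a b} → CoprimeP a b → Coprime a b
CoprimeP⇒Coprime coprime d d∣a d∣b = ∣P⇒∣ (coprime d (∣⇒∣P d∣a) (∣⇒∣P d∣b))

∣-≡mod : ∀ {d f p q} → d ∣ f → p ≡ q mod f → d ∣ q → d ∣ p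
∣-≡mod {p = p} {q} d∣f (mk≡mod f∣p+q) d∣q = ∣-respʳ (cancel p q) (∣-+P (∣-trans d∣f f∣p+q) d∣q)
  where
  cancel : ∀ p q → (p +P q) +P q ≋ p
  cancel = solve-∀ 𝔽₂[x]-ring

≡1-cancel : ∀ {c d f} z → c ≡ oneP mod f → d ∣ c → d ∣ f *P z → d ∣ z
≡1-cancel {c} {f = f} z (mk≡mod (divides q f*q≋c+1)) d∣c d∣fz =
  ∣-respʳ (≋-trans (+P-cong (≋-refl {c *P z}) (≋-trans (rearrange f q z) (*P-congˡ z f*q≋c+1))) (cancel c z))
          (∣-+P (∣-*Pʳ z d∣c) (∣-*Pʳ q d∣fz))
  where
  rearrange : ∀ f q z → (f *P z) *P q ≋ (f *P q) *P z
  rearrange = solve-∀ 𝔽₂[x]-ring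
  cancel : ∀ c z → c *P z +P (c +P oneP) *P z ≋ z
  cancel = solve-∀ 𝔽₂[x]-ring

coprime-if-gcds : ∀ {m k c z} a b e →
  gcd m a ≡ gcd m k → gcd m b ≡ gcd m k → gcd m e ≡ gcd m k →
  (z *P c) *P xm-1 k ^ 3 ≡ xm-1 a *P xm-1 b *P xm-1 e mod xm-1 m →
  c ≡ oneP mod xm-1 k → Coprime c (xm-1 m)
coprime-if-gcds {m} {k} {c} {z} a b e ga gb ge key c≡1 d d∣c d∣F =
  ≡1-cancel oneP c≡1 d∣c (≡1-cancel _ c≡1 d∣c (≡1-cancel _ c≡1 d∣c d∣K³))
  where
  A = xm-1 a
  B = xm-1 b
  C = xm-1 e
  G = xm-1 (gcd m k)
  K = xm-1 k
  reduce : ∀ {x} r → gcd m x ≡ gcd m k → d ∣ xm-1 x *P r → d ∣ G *P r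
  reduce {x} r eq d∣xr = ≡.subst (λ g → d ∣ xm-1 g *P r) eq (∣xm-1∧∣xm-1*⇒∣xm-1[gcd]* r d∣F d∣xr)
  swap : ∀ p q r → p *P (q *P r) ≋ q *P (p *P r)
  swap = solve-∀ 𝔽₂[x]-ring
  d∣ABC : d ∣ A *P (B *P (C *P oneP))
  d∣ABC = ∣-respʳ (≋-trans (*P-assoc A B C) (*P-congʳ A (*P-congʳ B (≋-sym (*P-identityʳ C)))))
                  (∣-≡mod d∣F (≡mod-sym key) (∣-*Pʳ (K ^ 3) (∣-*Pˡ z d∣c)))
  d∣GBC : d ∣ G *P (B *P (C *P oneP))
  d∣GBC = reduce (B *P (C *P oneP)) ga d∣ABC
  d∣GGC : d ∣ G *P (G *P (C *P oneP))
  d∣GGC = reduce (G *P (C *P oneP)) gb (∣-respʳ (swap G B _) d∣GBC)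
  d∣GGG : d ∣ G *P (G *P (G *P oneP))
  d∣GGG = reduce (G *P (G *P oneP)) ge
            (∣-respʳ (≋-trans (*P-congʳ G (swap G C oneP)) (swap G C (G *P oneP))) d∣GGC)
  G∣K : G ∣ K
  G∣K = ∣⇒xm-1∣xm-1 (gcd[m,n]∣n m k)
  d∣K³ : d ∣ K *P (K *P (K *P oneP))
  d∣K³ = ∣-trans d∣GGG (∣-*P G∣K (∣-*P G∣K (∣-*P G∣K ∣-refl)))

∣[1+2f]*k∧∣4*k⇒∣k : ∀ f {g k} → g ℕᵈ.∣ (1 + 2 * f) * k → g ℕᵈ.∣ 4 * k → g ℕᵈ.∣ k
∣[1+2f]*k∧∣4*k⇒∣k f {g} {k} g∣[1+2f]k g∣4k =
  ℕᵈ.∣m+n∣m⇒∣n (≡.subst (g ℕᵈ.∣_) split₁ g∣[1+2f]k) (ℕᵈ.∣n⇒∣m*n f g∣2k)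
  where
  split₁ : (1 + 2 * f) * k ≡ f * (2 * k) + k
  split₁ = ℕ-Solver.solve (f ∷ k ∷ [])
  split₂ : 2 * ((1 + 2 * f) * k) ≡ f * (4 * k) + 2 * k
  split₂ = ℕ-Solver.solve (f ∷ k ∷ [])
  g∣2k : g ℕᵈ.∣ 2 * k
  g∣2k = ℕᵈ.∣m+n∣m⇒∣n (≡.subst (g ℕᵈ.∣_) split₂ (ℕᵈ.∣n⇒∣m*n 2 g∣[1+2f]k)) (ℕᵈ.∣n⇒∣m*n f g∣4k)

gcd[m,e*k]≡gcd[m,k] : ∀ m e k → gcd m (e * k) ℕᵈ.∣ k → gcd m (e * k) ≡ gcd m k
gcd[m,e*k]≡gcd[m,k] m e k g∣k = ℕᵈ.∣-antisym
  (gcd-greatest (gcd[m,n]∣m m (e * k)) g∣k)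
  (gcd-greatest (gcd[m,n]∣m m k) (ℕᵈ.∣n⇒∣m*n e (gcd[m,n]∣n m k)))

gcd-if-coprime : ∀ {m k c N P} e f → e ≡ 1 + 2 * f → 1 ≤ m → Coprime c (xm-1 m) →
  (X^ N *P c) *P xm-1 k ^ 3 ≡ P mod xm-1 m →
  xm-1 (e * k) ∣ P → gcd m (e * k) ≡ gcd m k
gcd-if-coprime {m} {k} {c} {N} e f e≡odd 1≤m coprime key E∣P =
  gcd[m,e*k]≡gcd[m,k] m e k (∣[1+2f]*k∧∣4*k⇒∣k f g∣[1+2f]k g∣4k)
  where
  g = gcd m (e * k)
  H = xm-1 g
  K = xm-1 k
  H∣F : H ∣ xm-1 m
  H∣F = ∣⇒xm-1∣xm-1 (gcd[m,n]∣m m (e * k))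
  H∣Z : H ∣ (X^ N *P c) *P K ^ 3
  H∣Z = ∣-≡mod H∣F key (∣-trans (∣⇒xm-1∣xm-1 (gcd[m,n]∣n m (e * k))) E∣P)
  c⊥H : Coprime c H
  c⊥H d d∣c d∣H = coprime d d∣c (∣-trans d∣H H∣F)
  H∣X^K³ : H ∣ X^ N *P K ^ 3
  H∣X^K³ = coprime-divisor (X^ N *P K ^ 3) c⊥H (∣-respʳ (rearrange (X^ N) c (K ^ 3)) H∣Z)
    where
    rearrange : ∀ x c r → (x *P c) *P r ≋ c *P (x *P r)
    rearrange = solve-∀ 𝔽₂[x]-ring
  1≤g : 1 ≤ g
  1≤g = ℕ.n≢0⇒n>0 (gcd[m,n]≢0 m (e * k) (inj₁ (λ m≡0 → ℕ.<⇒≢ 1≤m (≡.sym m≡0))))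
  H∣xm-1[4k] : H ∣ xm-1 (4 * k)
  H∣xm-1[4k] = ∣-respʳ (≋-sym (xm-1[4*a]≋xm-1⁴ k)) (∣-*Pʳ K (xm-1∣X^*⇒xm-1∣ N (K ^ 3) 1≤g H∣X^K³))
  g∣4k : g ℕᵈ.∣ 4 * k
  g∣4k = xm-1∣xm-1⇒∣ 1≤g H∣xm-1[4k]
  g∣[1+2f]k : g ℕᵈ.∣ (1 + 2 * f) * k
  g∣[1+2f]k = ≡.subst (λ e → g ℕᵈ.∣ e * k) e≡odd (gcd[m,n]∣n m (e * k))

proposition10 : (m k t : ℕ) → 1 ≤ m → 1 ≤ k → 1 ≤ t → 4 * t + 1 < m →
    CoprimeP (cOfXk m k t) (xm-1 m) ⇔
      ((gcd m ((2 * t + 3) * k) ≡ gcd m k)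
        × (gcd m ((2 * t ∸ 1) * k) ≡ gcd m k)
        × (gcd m (3 * k) ≡ gcd m k))
proposition10 m k t@(suc n) 1≤m _ 1≤t 4t+1<m =
  mk⇔ (necessity ∘ CoprimeP⇒Coprime) (Coprime⇒CoprimeP ∘ sufficiency)
  where
  open KeyCongruence m k
  A = xm-1 ((2 * t + 3) * k)
  B = xm-1 ((2 * t ∸ 1) * k)
  C = xm-1 (3 * k)
  key : (Y (2 * t + 1) *P cOfXk m k t) *P xm-1 k ^ 3 ≡ A *P B *P C mod xm-1 m
  key = key-congruence t 1≤t
    (ℕ.≤-trans (ℕ.+-monoˡ-≤ 1 (ℕ.*-monoˡ-≤ t {2} {4} (s≤s (s≤s z≤n)))) (ℕ.<⇒≤ 4t+1<m))
  GcdConditions : Set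
  GcdConditions = (gcd m ((2 * t + 3) * k) ≡ gcd m k)
                × (gcd m ((2 * t ∸ 1) * k) ≡ gcd m k)
                × (gcd m (3 * k) ≡ gcd m k)
  necessity : Coprime (cOfXk m k t) (xm-1 m) → GcdConditions
  necessity c⊥F = odd-factor (2 * t + 3) (suc t) 2t+3≡1+2[t+1] (∣-*Pʳ C (∣-*Pʳ B ∣-refl))
                , odd-factor (2 * t ∸ 1) n (2[1+n]∸1≡1+2n n) (∣-*Pʳ C (∣-*Pˡ A ∣-refl))
                , odd-factor 3 1 refl (∣-*Pˡ (A *P B) ∣-refl)
    where
    odd-factor : ∀ e f → e ≡ 1 + 2 * f → xm-1 (e * k) ∣ A *P B *P C → gcd m (e * k) ≡ gcd m k
    odd-factor e f e≡odd = gcd-if-coprime {k = k} {N = (2 * t + 1) * k} e f e≡odd 1≤m c⊥F key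
    2t+3≡1+2[t+1] : 2 * suc n + 3 ≡ 1 + 2 * suc (suc n)
    2t+3≡1+2[t+1] = ℕ-Solver.solve (n ∷ [])
  sufficiency : GcdConditions → Coprime (cOfXk m k t) (xm-1 m)
  sufficiency (ga , gb , ge) = coprime-if-gcds {k = k} {z = Y (2 * t + 1)} _ _ _ ga gb ge key (cOfXk≡1 t)
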